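{- Let $u\ge 0$ be an integer. Then \[ \varphi(\Pi_{1,u})=2\left(e^{x/2}-1\right)^{u+1}. \]
   Context: A segmented permutation of size $n$ is a permutation $\sigma=\sigma_1\cdots\sigma_n$ of $\{1,\dots,n\}$ (as a word) together with a choice, for each $i\in\{1,\dots,n-1\}$, of whether a bar is placed between $\sigma_i$ and $\sigma_{i+1}$; $SP_n$ is their set. A position $i<n$ is a segmentation if there is a bar there, and a descent if it is not a segmentation and $\sigma_i>\sigma_{i+1}$. A segmented composition of $n\ge1$ is a sequence $I=(i_1,\dots,i_r)$ of positive integers summing to $n$, consecutive entries separated by a comma or a bar; $\ell(I)=r$, $\operatorname{seg}(I)$ = number of bars, $\operatorname{des}(I)=\ell(I)-\operatorname{seg}(I)$; $\operatorname{Des}(I)$ (resp. $\operatorname{Bar}(I)$) is the set of partial sums $i_1+\cdots+i_k$, $k<r$, with $i_k$ followed by a comma (resp. a bar). $\operatorname{SCDes}(\sigma)$ is the segmented composition of $n$ whose $\operatorname{Des}$ set is the set of descents of $\sigma$ and whose $\operatorname{Bar}$ set is the set of segmentations of $\sigma$. For segmented compositions $I,K$ of the same $n$, $I\succeq K$ iff $\operatorname{Des}(I)\supseteq\operatorname{Des}(K)$ and $\operatorname{Bar}(I)\subseteq\operatorname{Bar}(K)\subseteq\operatorname{Des}(I)\cup\operatorname{Bar}(I)$. Consider formal (possibly infinite, locally finite in each size) linear combinations of symbols $G_\sigma$, $\sigma\in\bigcup_{n\ge1}SP_n$. Put $R_K=\sum_{\sigma:\operatorname{SCDes}(\sigma)=K}G_\sigma$,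 $S^I=\sum_{K:\,I\succeq K}R_K$, and $\Pi_{1,u}=\sum_{n\ge1}\sum_{I}S^I$, where the inner sum runs over segmented compositions $I$ of $n$ with $\operatorname{des}(I)=1$ and $\operatorname{seg}(I)=u$. Let $\varphi$ be the linear map (extended to such formal sums) to formal power series in $x$ defined by $\varphi(G_\sigma)=\dfrac{x^n}{2^{n-1}n!}$ for $\sigma\in SP_n$. -}

module Defs where

open import Data.Bool using (Bool; true; false; _∧_; _∨_; not; if_then_else_)
open import Data.Nat using (ℕ; zero; suc; _∸_; _^_; _<ᵇ_; _≡ᵇ_; NonZero) renaming (_+_ to _+ℕ_; _*_ to _*ℕ_)
open import Data.Nat.Properties using (m*n≢0; m^n≢0; _!≢0)
open import Data.Nat.Base using (_!)
open import Data.Fin using (Fin; toℕ; inject₁) renaming (suc to fsuc)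
open import Data.Fin.Base using ()
open import Data.List using (List; []; _∷_; [_]; map; concatMap; foldr; filter; upTo; allFin)
open import Data.Bool.ListAction using (any; and)
open import Data.Vec using (Vec; lookup; tabulate; toList; zipWith) renaming ([] to []ᵥ; _∷_ to _∷ᵥ_)
open import Data.Product using (_×_; _,_; proj₁; proj₂)
open import Data.Integer using (+_)
open import Data.Rational using (ℚ; 0ℚ; 1ℚ; _+_; _*_; _-_; _/_)

allVec : {A : Set} → List A → (n : ℕ) → List (Vec A n)
allVec xs zero    = [ []ᵥ ]
allVec xs (suc n) = concatMap (λ x → map (x ∷ᵥ_) (allVec xs n)) xs

sumℚ : List ℚ → ℚ
sumℚ = foldr _+_ 0ℚ

Σ[_∣_]_ : {A : Set} → List A → (A → Bool) → (A → ℚ) → ℚ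
Σ[ xs ∣ p ] f = sumℚ (map (λ x → if p x then f x else 0ℚ) xs)

implies : Bool → Bool → Bool
implies a b = not a ∨ b

-- A segmented composition of suc m is encoded by what sits at each of the
-- m internal positions 1..m (Fin m, position i ↔ partial sum i+1):
-- nothing (not a partial sum), a comma (element of Des), or a bar (element of Bar).

data Sep : Set where
  noSep comma bar : Sep

allSep : List Sep
allSep = noSep ∷ comma ∷ bar ∷ []

isComma : Sep → Bool
isComma comma = true
isComma _     = false

isBar : Sep → Bool
isBar bar = true
isBar _   = false

isSep : Sep → Bool
isSep noSep = false
isSep _     = true

_==ˢ_ : Sep → Sep → Bool
noSep ==ˢ noSep = true
comma ==ˢ comma = true
bar   ==ˢ bar   = true
_     ==ˢ _     = false

SegComp : ℕ → Set
SegComp m = Vec Sep m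

countV : {m : ℕ} → (Sep → Bool) → Vec Sep m → ℕ
countV p v = foldr (λ s k → if p s then suc k else k) 0 (toList v)

-- ℓ(I) = number of parts = number of separators + 1
len : {m : ℕ} → SegComp m → ℕ
len I = suc (countV isSep I)

seg : {m : ℕ} → SegComp m → ℕ
seg I = countV isBar I

des : {m : ℕ} → SegComp m → ℕ
des I = len I ∸ seg I

sameComp : {m : ℕ} → SegComp m → SegComp m → Bool
sameComp I K = and (toList (zipWith _==ˢ_ I K))

-- I ⪰ K :  Des(I) ⊇ Des(K)  and  Bar(I) ⊆ Bar(K) ⊆ Des(I) ∪ Bar(I)
succeq : {m : ℕ} → SegComp m → SegComp m → Bool
succeq I K = and (toList (zipWith pt I K))
  where
  pt : Sep → Sep → Bool
  pt i k = implies (isComma k) (isComma i)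
         ∧ implies (isBar i) (isBar k)
         ∧ implies (isBar k) (isComma i ∨ isBar i)

-- Segmented permutations of size n = suc m.
-- σ is a word in Fin (suc m) (values 0..m standing for 1..suc m, order preserved)
-- with pairwise distinct letters, together with a bar choice at each of the
-- m gaps (true = bar between σ_{i} and σ_{i+1}).

distinct : {k : ℕ} → List (Fin k) → Bool
distinct []       = true
distinct (x ∷ xs) = not (any (λ y → toℕ x ≡ᵇ toℕ y) xs) ∧ distinct xs

SegPerm : ℕ → Set
SegPerm m = Vec (Fin (suc m)) (suc m) × Vec Bool m

allSP : (m : ℕ) → List (SegPerm m)
allSP m = concatMap (λ w → map (λ b → (w , b)) (allVec (true ∷ false ∷ []) m))
                    (filter (λ w → Data.Bool.T? (distinct (toList w))) (allVec (allFin (suc m)) (suc m)))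
  where import Data.Bool

SCDes : {m : ℕ} → SegPerm m → SegComp m
SCDes {m} (w , b) = tabulate pos
  where
  pos : Fin m → Sep
  pos i = if lookup b i then bar
          else (if toℕ (lookup w (fsuc i)) <ᵇ toℕ (lookup w (inject₁ i)) then comma else noSep)

-- φ(G_σ) = x^n / (2^(n-1) n!)  for σ ∈ SP_n ; here n = suc m, so 2^(n-1) = 2^m

φweight : ℕ → ℚ
φweight m = (+ 1 / (2 ^ m *ℕ (suc m) !)) {{m*n≢0 (2 ^ m) ((suc m) !) {{m^n≢0 2 m}} {{(suc m) !≢0}}}}

-- Formal power series in x with rational coefficients: n ↦ coefficient of x^n
PS : Set
PS = ℕ → ℚ

-- coefficient of x^n in φ(Π_{1,u})
--   Π_{1,u} = Σ_{n≥1} Σ_{I ⊨ n, des I = 1, seg I = u} S^I,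
--   S^I = Σ_{K : I ⪰ K} R_K,   R_K = Σ_{σ : SCDes σ = K} G_σ
φΠ : ℕ → PS
φΠ u zero    = 0ℚ
φΠ u (suc m) =
  Σ[ allVec allSep m ∣ (λ I → (des I ≡ᵇ 1) ∧ (seg I ≡ᵇ u)) ] λ I →
    Σ[ allVec allSep m ∣ succeq I ] λ K →
      Σ[ allSP m ∣ (λ σ → sameComp (SCDes σ) K) ] λ σ →
        φweight m

oneS : PS
oneS zero    = 1ℚ
oneS (suc _) = 0ℚ

_-ˢ_ : PS → PS → PS
(f -ˢ g) n = f n - g n

_*ˢ_ : PS → PS → PS
(f *ˢ g) n = sumℚ (map (λ k → f k * g (n ∸ k)) (upTo (suc n)))

_^ˢ_ : PS → ℕ → PS
f ^ˢ zero  = oneS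
f ^ˢ suc k = f *ˢ (f ^ˢ k)

scaleˢ : ℚ → PS → PS
scaleˢ c f n = c * f n

-- e^{x/2} = Σ x^n / (2^n n!)
expHalf : PS
expHalf n = (+ 1 / (2 ^ n *ℕ n !)) {{m*n≢0 (2 ^ n) (n !) {{m^n≢0 2 n}} {{n !≢0}}}}

rhsSeries : ℕ → PS
rhsSeries u = scaleˢ (+ 2 / 1) ((expHalf -ˢ oneS) ^ˢ suc u)

module Submission where

-- A segmented composition I with des I = 1 has no commas, and then I ⪰ K forces
-- K = I.  So the coefficient of x^{1+m} in φ(Π_{1,u}) is N / (2^m (1+m)!), where N
-- counts the segmented permutations of size 1+m whose SCDes has no commas and u
-- bars: permutations cut by u bars into 1+u increasing runs, i.e. ordered set
-- partitions of a (1+m)-set into 1+u blocks.  Their number ordPart (1+u) (1+m)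
-- satisfies ordPart (1+k) n = Σ_{j<n} C(n,1+j) ordPart k (n−1−j), which says exactly
-- that the coefficient of xⁿ in (e^{x/2} − 1)ᵏ is ordPart k n / (2ⁿ n!).
--
-- The count N is computed letter by letter (module Runs): the number of ways to
-- finish a partial word depends only on how many letters remain, how many of them
-- lie above the last letter, and how many bars remain; this is the function
-- `extensions`, whose closed form in terms of ordPart is proved first.

open import Data.Bool using (Bool; true; false; _∧_; _∨_; not; if_then_else_)
open import Data.Nat using (ℕ; zero; suc; _+_; _*_; _∸_; _<_; _≤_; z≤n; s≤s; _!; _<ᵇ_; _≡ᵇ_; _^_; NonZero)
open import Data.Bool.Properties using (∧-zeroʳ; ∧-identityʳ; ∧-assoc; ∧-conicalˡ; ∨-commutativeMonoid)
open import Data.Bool.ListAction using (any)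
open import Algebra.Bundles using (CommutativeMonoid)
open import Data.Nat.Combinatorics using (_C_; nCk≡n!/k![n-k]!; k>n⇒nCk≡0; k![n∸k]!∣n!; nCk+nC[k+1]≡[n+1]C[k+1])
open import Data.Nat.DivMod using (_/_; m/n*n≡m)
open import Data.Nat.Properties
open import Data.List using (List; []; _∷_; _++_; map; concatMap; filter; tabulate; allFin; applyUpTo)
open import Data.Product using (_,_)
open import Data.List.Relation.Unary.All using (All; []; _∷_; universal)
open import Data.List.Relation.Unary.All.Properties using (applyUpTo⁺₁)
open import Data.Nat.Tactic.RingSolver using (solve-∀)
import Data.Integer as ℤ
import Data.Integer.Properties as ℤ
open import Data.Rational using (ℚ; 0ℚ; toℚᵘ) renaming (_+_ to _+ℚ_; _*_ to _*ℚ_; _/_ to _/ℚ_)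
import Data.Rational.Properties as ℚ
open import Data.Rational.Unnormalised using (mkℚᵘ; *≡*) renaming (_≃_ to _≃ᵘ_)
import Data.Rational.Unnormalised.Properties as ℚᵘ
open import Data.Vec using (Vec; toList; lookup) renaming ([] to []ᵥ; _∷_ to _∷ᵥ_)
open import Data.Fin using (Fin; toℕ; inject₁) renaming (zero to fzero; suc to fsuc)
open import Function using (_∘_)
open import Relation.Nullary.Decidable.Core using (T?)
open import Relation.Binary.PropositionalEquality
import Algebra.Properties.CommutativeSemigroup as CommSemigroupProperties
import Data.Vec

open import Defs

∑ : {A : Set} → List A → (A → ℕ) → ℕ
∑ []       f = 0
∑ (x ∷ xs) f = f x + ∑ xs f

∑< : ℕ → (ℕ → ℕ) → ℕ
∑< zero    f = 0
∑< (suc n) f = f 0 + ∑< n (f ∘ suc)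

open CommSemigroupProperties +-commutativeSemigroup using (interchange)

∑-cong : {A : Set} (xs : List A) {f g : A → ℕ} → (∀ x → f x ≡ g x) → ∑ xs f ≡ ∑ xs g
∑-cong []       f≡g = refl
∑-cong (x ∷ xs) f≡g = cong₂ _+_ (f≡g x) (∑-cong xs f≡g)

∑-++ : {A : Set} (xs ys : List A) (f : A → ℕ) → ∑ (xs ++ ys) f ≡ ∑ xs f + ∑ ys f
∑-++ []       ys f = refl
∑-++ (x ∷ xs) ys f = trans (cong (f x +_) (∑-++ xs ys f)) (sym (+-assoc (f x) _ _))

∑-map : {A B : Set} (g : A → B) (xs : List A) (f : B → ℕ) → ∑ (map g xs) f ≡ ∑ xs (f ∘ g)
∑-map g []       f = refl
∑-map g (x ∷ xs) f = cong (f (g x) +_) (∑-map g xs f)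

∑-concatMap : {A B : Set} (g : A → List B) (xs : List A) (f : B → ℕ) →
              ∑ (concatMap g xs) f ≡ ∑ xs (λ x → ∑ (g x) f)
∑-concatMap g []       f = refl
∑-concatMap g (x ∷ xs) f =
  trans (∑-++ (g x) (concatMap g xs) f) (cong (∑ (g x) f +_) (∑-concatMap g xs f))

∑-+ : {A : Set} (xs : List A) (f g : A → ℕ) → ∑ xs (λ x → f x + g x) ≡ ∑ xs f + ∑ xs g
∑-+ []       f g = refl
∑-+ (x ∷ xs) f g = trans (cong (f x + g x +_) (∑-+ xs f g)) (interchange (f x) (g x) _ _)

∑-*ˡ : {A : Set} (xs : List A) (c : ℕ) (f : A → ℕ) → ∑ xs (λ x → c * f x) ≡ c * ∑ xs f
∑-*ˡ []       c f = sym (*-zeroʳ c)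
∑-*ˡ (x ∷ xs) c f = trans (cong (c * f x +_) (∑-*ˡ xs c f)) (sym (*-distribˡ-+ c (f x) _))

∑-zero : {A : Set} (xs : List A) → ∑ xs (λ _ → 0) ≡ 0
∑-zero []       = refl
∑-zero (x ∷ xs) = ∑-zero xs

∑-swap : {A B : Set} (xs : List A) (ys : List B) (f : A → B → ℕ) →
         ∑ xs (λ x → ∑ ys (f x)) ≡ ∑ ys (λ y → ∑ xs (λ x → f x y))
∑-swap []       ys f = sym (∑-zero ys)
∑-swap (x ∷ xs) ys f =
  trans (cong (∑ ys (f x) +_) (∑-swap xs ys f)) (sym (∑-+ ys (f x) (λ y → ∑ xs (λ x′ → f x′ y))))

∑-filter : {A : Set} (p : A → Bool) (xs : List A) (f : A → ℕ) →
           ∑ (filter (λ x → T? (p x)) xs) f ≡ ∑ xs (λ x → if p x then f x else 0)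
∑-filter p []       f = refl
∑-filter p (x ∷ xs) f with p x
... | true  = cong (f x +_) (∑-filter p xs f)
... | false = ∑-filter p xs f

∑-allVec : {A : Set} (xs : List A) (k : ℕ) (f : Vec A (suc k) → ℕ) →
           ∑ (allVec xs (suc k)) f ≡ ∑ xs (λ x → ∑ (allVec xs k) (λ v → f (x ∷ᵥ v)))
∑-allVec xs k f = trans (∑-concatMap _ xs f) (∑-cong xs (λ x → ∑-map (x ∷ᵥ_) (allVec xs k) f))

∑-tabulate : {A : Set} (n : ℕ) (g : Fin n → A) (f : A → ℕ) (h : ℕ → ℕ) →
             (∀ i → f (g i) ≡ h (toℕ i)) → ∑ (tabulate g) f ≡ ∑< n h
∑-tabulate zero    g f h e = refl
∑-tabulate (suc n) g f h e = cong₂ _+_ (e fzero) (∑-tabulate n (g ∘ fsuc) f (h ∘ suc) (e ∘ fsuc))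

∑<-cong : ∀ n {f g : ℕ → ℕ} → (∀ i → i < n → f i ≡ g i) → ∑< n f ≡ ∑< n g
∑<-cong zero    f≡g = refl
∑<-cong (suc n) f≡g = cong₂ _+_ (f≡g 0 (s≤s z≤n)) (∑<-cong n (λ i i<n → f≡g (suc i) (s≤s i<n)))

∑<-snoc : ∀ n f → ∑< (suc n) f ≡ ∑< n f + f n
∑<-snoc zero    f = +-comm (f 0) 0
∑<-snoc (suc n) f = trans (cong (f 0 +_) (∑<-snoc n (f ∘ suc))) (sym (+-assoc (f 0) _ _))

∑<-+ : ∀ n (f g : ℕ → ℕ) → ∑< n (λ i → f i + g i) ≡ ∑< n f + ∑< n g
∑<-+ zero    f g = refl
∑<-+ (suc n) f g = trans (cong (f 0 + g 0 +_) (∑<-+ n (f ∘ suc) (g ∘ suc))) (interchange (f 0) (g 0) _ _)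

∑<-const : ∀ n → ∑< n (λ _ → 1) ≡ n
∑<-const zero    = refl
∑<-const (suc n) = cong suc (∑<-const n)

∑-applyUpTo : ∀ (s : ℕ → ℕ) n (h : ℕ → ℕ) → ∑ (applyUpTo s n) h ≡ ∑< n (h ∘ s)
∑-applyUpTo s zero    h = refl
∑-applyUpTo s (suc n) h = cong (h (s 0) +_) (∑-applyUpTo (s ∘ suc) n h)

C-factorial : ∀ {n k} → k ≤ n → (n C k) * (k ! * (n ∸ k) !) ≡ n !
C-factorial {n} {k} k≤n = begin
  (n C k) * (k ! * (n ∸ k) !)                    ≡⟨ cong (_* (k ! * (n ∸ k) !)) (nCk≡n!/k![n-k]! k≤n) ⟩
  (n ! / (k ! * (n ∸ k) !)) * (k ! * (n ∸ k) !)  ≡⟨ m/n*n≡m (k![n∸k]!∣n! k≤n) ⟩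
  n !                                            ∎
  where
  open ≡-Reasoning
  instance
    denominator≢0 : NonZero (k ! * (n ∸ k) !)
    denominator≢0 = k !* (n ∸ k) !≢0

∑-pascal : ∀ a (h : ℕ → ℕ) →
           ∑< a (λ i → ∑< (suc i) (λ j → (i C j) * h j)) ≡ ∑< a (λ j → (a C suc j) * h j)
∑-pascal zero    h = refl
∑-pascal (suc a) h = begin
  ∑< (suc a) (λ i → ∑< (suc i) (λ j → (i C j) * h j))
    ≡⟨ ∑<-snoc a _ ⟩
  ∑< a (λ i → ∑< (suc i) (λ j → (i C j) * h j)) + ∑< (suc a) (λ j → (a C j) * h j)
    ≡⟨ cong (_+ ∑< (suc a) (λ j → (a C j) * h j)) (∑-pascal a h) ⟩
  ∑< a (λ j → (a C suc j) * h j) + ∑< (suc a) (λ j → (a C j) * h j)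
    ≡⟨ cong (_+ ∑< (suc a) (λ j → (a C j) * h j)) (sym lastTermVanishes) ⟩
  ∑< (suc a) (λ j → (a C suc j) * h j) + ∑< (suc a) (λ j → (a C j) * h j)
    ≡⟨ +-comm (∑< (suc a) (λ j → (a C suc j) * h j)) _ ⟩
  ∑< (suc a) (λ j → (a C j) * h j) + ∑< (suc a) (λ j → (a C suc j) * h j)
    ≡⟨ sym (∑<-+ (suc a) (λ j → (a C j) * h j) (λ j → (a C suc j) * h j)) ⟩
  ∑< (suc a) (λ j → (a C j) * h j + (a C suc j) * h j)
    ≡⟨ ∑<-cong (suc a) (λ j _ → trans (sym (*-distribʳ-+ (h j) (a C j) (a C suc j)))
                                        (cong (_* h j) (nCk+nC[k+1]≡[n+1]C[k+1] a j))) ⟩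
  ∑< (suc a) (λ j → (suc a C suc j) * h j)
    ∎
  where
  open ≡-Reasoning
  lastTermVanishes : ∑< (suc a) (λ j → (a C suc j) * h j) ≡ ∑< a (λ j → (a C suc j) * h j)
  lastTermVanishes = begin
    ∑< (suc a) (λ j → (a C suc j) * h j)   ≡⟨ ∑<-snoc a _ ⟩
    ∑< a (λ j → (a C suc j) * h j) + (a C suc a) * h a
      ≡⟨ cong (λ c → ∑< a (λ j → (a C suc j) * h j) + c * h a) (k>n⇒nCk≡0 (n<1+n a)) ⟩
    ∑< a (λ j → (a C suc j) * h j) + 0     ≡⟨ +-identityʳ _ ⟩
    ∑< a (λ j → (a C suc j) * h j)         ∎

expDenominator-split : ∀ {n j} → j ≤ n → (2 ^ j * j !) * (2 ^ (n ∸ j) * (n ∸ j) !) * (n C j) ≡ 2 ^ n * n !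
expDenominator-split {n} {j} j≤n = begin
  (2 ^ j * j !) * (2 ^ (n ∸ j) * (n ∸ j) !) * (n C j)
    ≡⟨ regroup (2 ^ j) (j !) (2 ^ (n ∸ j)) ((n ∸ j) !) (n C j) ⟩
  (2 ^ j * 2 ^ (n ∸ j)) * ((n C j) * (j ! * (n ∸ j) !))
    ≡⟨ cong₂ _*_ (trans (sym (^-distribˡ-+-* 2 j (n ∸ j))) (cong (2 ^_) (m+[n∸m]≡n j≤n))) (C-factorial j≤n) ⟩
  2 ^ n * n !
    ∎
  where
  open ≡-Reasoning
  regroup : ∀ a f b g c → (a * f) * (b * g) * c ≡ (a * b) * (c * (f * g))
  regroup = solve-∀

-- ordPart k n counts ordered partitions of an n-set into k nonempty blocks:
-- choose the 1 + j elements of the first block, then partition the rest.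
ordPart : ℕ → ℕ → ℕ
ordPart zero    zero    = 1
ordPart zero    (suc n) = 0
ordPart (suc k) n       = ∑< n (λ j → (n C suc j) * ordPart k (n ∸ suc j))

-- extensions k a u counts the ways to finish a word of distinct letters into
-- increasing runs when k letters remain to be placed, a of them lie above the
-- current last letter, and u more run breaks (bars) must be used.  The next
-- letter either continues the run (one of the a larger letters, leaving i < a
-- above it) or starts a new run after a bar (any of the 1 + k letters).
extensions : ℕ → ℕ → ℕ → ℕ
extensions zero    a zero    = 1
extensions zero    a (suc u) = 0
extensions (suc k) a zero    = ∑< a (λ i → extensions k i zero)
extensions (suc k) a (suc u) = ∑< a (λ i → extensions k i (suc u)) + ∑< (suc k) (λ i → extensions k i u)

-- Closed form: continue the current run with j of the a larger letters and
-- split the remaining m ∸ j letters into u ordered runs.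
extensions-closed : ∀ m a → a ≤ m → ∀ u →
                    extensions m a u ≡ ∑< (suc a) (λ j → (a C j) * ordPart u (m ∸ j))

-- Choosing the first letter freely gives all ordered partitions into 1 + u runs.
extensions-total : ∀ m u → ∑< (suc m) (λ i → extensions m i u) ≡ ordPart (suc u) (suc m)
extensions-total m u = begin
  ∑< (suc m) (λ i → extensions m i u)
    ≡⟨ ∑<-cong (suc m) (λ i i<1+m → extensions-closed m i (≤-pred i<1+m) u) ⟩
  ∑< (suc m) (λ i → ∑< (suc i) (λ j → (i C j) * ordPart u (m ∸ j)))
    ≡⟨ ∑-pascal (suc m) (λ j → ordPart u (m ∸ j)) ⟩
  ordPart (suc u) (suc m)
    ∎
  where open ≡-Reasoning

-- Unfolding one step: the bar alternative contributes ordPart u (1 + m) in both cases.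
extensions-suc : ∀ m a u → extensions (suc m) a u ≡ ∑< a (λ i → extensions m i u) + ordPart u (suc m)
extensions-suc m a zero    = sym (+-identityʳ _)
extensions-suc m a (suc u) = cong (∑< a (λ i → extensions m i (suc u)) +_) (extensions-total m u)

extensions-closed zero    zero z≤n zero    = refl
extensions-closed zero    zero z≤n (suc u) = refl
extensions-closed (suc m) a    a≤1+m u   = begin
  extensions (suc m) a u
    ≡⟨ extensions-suc m a u ⟩
  ∑< a (λ i → extensions m i u) + ordPart u (suc m)
    ≡⟨ cong (_+ ordPart u (suc m)) (∑<-cong a (λ i i<a → extensions-closed m i (≤-pred (≤-trans i<a a≤1+m)) u)) ⟩
  ∑< a (λ i → ∑< (suc i) (λ j → (i C j) * ordPart u (m ∸ j))) + ordPart u (suc m)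
    ≡⟨ cong (_+ ordPart u (suc m)) (∑-pascal a (λ j → ordPart u (m ∸ j))) ⟩
  ∑< a (λ j → (a C suc j) * ordPart u (m ∸ j)) + ordPart u (suc m)
    ≡⟨ +-comm _ (ordPart u (suc m)) ⟩
  ordPart u (suc m) + ∑< a (λ j → (a C suc j) * ordPart u (m ∸ j))
    ≡⟨ cong (_+ ∑< a (λ j → (a C suc j) * ordPart u (m ∸ j))) (sym (*-identityˡ (ordPart u (suc m)))) ⟩
  ∑< (suc a) (λ j → (a C j) * ordPart u (suc m ∸ j))
    ∎
  where open ≡-Reasoning

𝟙 : Bool → ℕ
𝟙 true  = 1
𝟙 false = 0

𝟙-∧ : ∀ a b → 𝟙 (a ∧ b) ≡ 𝟙 a * 𝟙 b
𝟙-∧ true  b = sym (+-identityʳ (𝟙 b))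
𝟙-∧ false b = refl

atLeast : ℕ → ℕ → Bool
atLeast t z = not (z <ᵇ t)

atLeast-suc : ∀ z w → not (z ≡ᵇ w) ∧ atLeast z w ≡ atLeast (suc z) w
atLeast-suc zero    zero    = refl
atLeast-suc zero    (suc w) = refl
atLeast-suc (suc z) zero    = refl
atLeast-suc (suc z) (suc w) = atLeast-suc z w

countAbove : ℕ → (ℕ → Bool) → ℕ → ℕ
countAbove n F t = ∑< n (λ z → 𝟙 (F z ∧ atLeast t z))

countAbove-suc : ∀ n F t → countAbove (suc n) F (suc t) ≡ countAbove n (F ∘ suc) t
countAbove-suc n F t = cong (λ b → 𝟙 b + countAbove n (F ∘ suc) t) (∧-zeroʳ (F 0))

-- Re-indexing by rank: as z runs over the marked elements z ≥ t, the number of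
-- marked elements above z runs exactly once over 0, 1, …, countAbove n F t − 1.
∑-byRank : ∀ n (F : ℕ → Bool) t (G : ℕ → ℕ) →
           ∑< n (λ z → 𝟙 (F z ∧ atLeast t z) * G (countAbove n F (suc z))) ≡ ∑< (countAbove n F t) G
∑-byRank zero    F t       G = refl
∑-byRank (suc n) F zero    G = begin
  𝟙 (F 0 ∧ true) * G (countAbove (suc n) F 1)
    + ∑< n (λ z → 𝟙 (F (suc z) ∧ true) * G (countAbove (suc n) F (suc (suc z))))
    ≡⟨ cong₂ (λ x y → 𝟙 (F 0 ∧ true) * G x + y) (countAbove-suc n F 0)
             (∑<-cong n (λ z _ → cong (λ x → 𝟙 (F (suc z) ∧ true) * G x) (countAbove-suc n F (suc z)))) ⟩
  𝟙 (F 0 ∧ true) * G rest + ∑< n (λ z → 𝟙 (F (suc z) ∧ true) * G (countAbove n (F ∘ suc) (suc z)))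
    ≡⟨ cong (𝟙 (F 0 ∧ true) * G rest +_) (∑-byRank n (F ∘ suc) zero G) ⟩
  𝟙 (F 0 ∧ true) * G rest + ∑< rest G
    ≡⟨ topTerm (F 0 ∧ true) ⟩
  ∑< (𝟙 (F 0 ∧ true) + rest) G
    ∎
  where
  open ≡-Reasoning
  rest : ℕ
  rest = countAbove n (F ∘ suc) 0
  topTerm : ∀ b → 𝟙 b * G rest + ∑< rest G ≡ ∑< (𝟙 b + rest) G
  topTerm true  = trans (cong (_+ ∑< rest G) (+-identityʳ (G rest)))
                        (trans (+-comm (G rest) _) (sym (∑<-snoc rest G)))
  topTerm false = refl
∑-byRank (suc n) F (suc t) G = begin
  𝟙 (F 0 ∧ false) * G (countAbove (suc n) F 1)
    + ∑< n (λ z → 𝟙 (F (suc z) ∧ atLeast t z) * G (countAbove (suc n) F (suc (suc z))))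
    ≡⟨ cong₂ (λ x y → 𝟙 x * G (countAbove (suc n) F 1) + y) (∧-zeroʳ (F 0))
             (∑<-cong n (λ z _ → cong (λ x → 𝟙 (F (suc z) ∧ atLeast t z) * G x) (countAbove-suc n F (suc z)))) ⟩
  ∑< n (λ z → 𝟙 (F (suc z) ∧ atLeast t z) * G (countAbove n (F ∘ suc) (suc z)))
    ≡⟨ ∑-byRank n (F ∘ suc) t G ⟩
  ∑< (countAbove n (F ∘ suc) t) G
    ≡⟨ cong (λ x → ∑< x G) (sym (countAbove-suc n F t)) ⟩
  ∑< (countAbove (suc n) F (suc t)) G
    ∎
  where open ≡-Reasoning

∑-unmark : ∀ n (F : ℕ → Bool) z → z < n →
           ∑< n (λ w → 𝟙 (F w ∧ not (z ≡ᵇ w))) + 𝟙 (F z) ≡ ∑< n (𝟙 ∘ F)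
∑-unmark (suc n) F zero    _ = begin
  𝟙 (F 0 ∧ false) + ∑< n (λ w → 𝟙 (F (suc w) ∧ true)) + 𝟙 (F 0)
    ≡⟨ cong₂ (λ x y → 𝟙 x + y + 𝟙 (F 0)) (∧-zeroʳ (F 0))
             (∑<-cong n (λ w _ → cong 𝟙 (∧-identityʳ (F (suc w))))) ⟩
  ∑< n (λ w → 𝟙 (F (suc w))) + 𝟙 (F 0)
    ≡⟨ +-comm _ (𝟙 (F 0)) ⟩
  𝟙 (F 0) + ∑< n (λ w → 𝟙 (F (suc w)))
    ∎
  where open ≡-Reasoning
∑-unmark (suc n) F (suc z) (s≤s z<n) = begin
  𝟙 (F 0 ∧ true) + ∑< n (λ w → 𝟙 (F (suc w) ∧ not (z ≡ᵇ w))) + 𝟙 (F (suc z))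
    ≡⟨ +-assoc (𝟙 (F 0 ∧ true)) _ _ ⟩
  𝟙 (F 0 ∧ true) + (∑< n (λ w → 𝟙 (F (suc w) ∧ not (z ≡ᵇ w))) + 𝟙 (F (suc z)))
    ≡⟨ cong₂ _+_ (cong 𝟙 (∧-identityʳ (F 0))) (∑-unmark n (F ∘ suc) z z<n) ⟩
  𝟙 (F 0) + ∑< n (λ w → 𝟙 (F (suc w)))
    ∎
  where open ≡-Reasoning

-- Sets of letters are predicates on ℕ; insert U y adds the letter y.
insert : (ℕ → Bool) → ℕ → ℕ → Bool
insert U y z = U z ∨ (y ≡ᵇ z)

bools : List Bool
bools = true ∷ false ∷ []

module Runs (n : ℕ) where

  -- valid U t w b u: the letters of w are distinct and avoid U; the bar flag b_i
  -- sits just before w_i; every unbarred step (starting from the preceding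
  -- letter t) goes up; and exactly u bars are used.
  valid : ∀ {k} → (ℕ → Bool) → ℕ → Vec (Fin n) k → Vec Bool k → ℕ → Bool
  valid U t []ᵥ       []ᵥ           zero    = true
  valid U t []ᵥ       []ᵥ           (suc u) = false
  valid U t (y ∷ᵥ w) (true ∷ᵥ b)  zero    = false
  valid U t (y ∷ᵥ w) (true ∷ᵥ b)  (suc u) =
    not (U (toℕ y)) ∧ valid (insert U (toℕ y)) (toℕ y) w b u
  valid U t (y ∷ᵥ w) (false ∷ᵥ b) u       =
    (not (U (toℕ y)) ∧ atLeast t (toℕ y)) ∧ valid (insert U (toℕ y)) (toℕ y) w b u

  count : ℕ → (ℕ → Bool) → ℕ → ℕ → ℕ
  count k U t u = ∑ (allVec (allFin n) k) (λ w → ∑ (allVec bools k) (λ b → 𝟙 (valid U t w b u)))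

  free : (ℕ → Bool) → ℕ → ℕ
  free U t = countAbove n (not ∘ U) t

  ∑-firstLetter : ∀ k (U : ℕ → Bool) t u (step : Bool → ℕ → Bool) (next : Bool → ℕ) →
    (∀ y c w b → 𝟙 (valid U t (y ∷ᵥ w) (c ∷ᵥ b) u)
                 ≡ 𝟙 (step c (toℕ y)) * 𝟙 (valid (insert U (toℕ y)) (toℕ y) w b (next c))) →
    count (suc k) U t u ≡ ∑< n (λ z → ∑ bools (λ c → 𝟙 (step c z) * count k (insert U z) z (next c)))
  ∑-firstLetter k U t u step next unfold =
    trans (∑-allVec (allFin n) k _) (∑-tabulate n (λ y → y) _ _ perLetter)
    where
    words : List (Vec (Fin n) k)
    words = allVec (allFin n) k
    flags : List (Vec Bool k)
    flags = allVec bools k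
    perLetter : ∀ y → ∑ words (λ w → ∑ (allVec bools (suc k)) (λ b → 𝟙 (valid U t (y ∷ᵥ w) b u)))
                      ≡ ∑ bools (λ c → 𝟙 (step c (toℕ y)) * count k (insert U (toℕ y)) (toℕ y) (next c))
    perLetter y = begin
      ∑ words (λ w → ∑ (allVec bools (suc k)) (λ b → 𝟙 (valid U t (y ∷ᵥ w) b u)))
        ≡⟨ ∑-cong words (λ w → ∑-allVec bools k _) ⟩
      ∑ words (λ w → ∑ bools (λ c → ∑ flags (λ b → 𝟙 (valid U t (y ∷ᵥ w) (c ∷ᵥ b) u))))
        ≡⟨ ∑-cong words (λ w → ∑-cong bools (λ c → trans (∑-cong flags (unfold y c w))
                                                       (∑-*ˡ flags (𝟙 (step c z)) _))) ⟩
      ∑ words (λ w → ∑ bools (λ c → 𝟙 (step c z) * ∑ flags (λ b → 𝟙 (valid U′ z w b (next c)))))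
        ≡⟨ ∑-swap words bools (λ w c → 𝟙 (step c z) * ∑ flags (λ b → 𝟙 (valid U′ z w b (next c)))) ⟩
      ∑ bools (λ c → ∑ words (λ w → 𝟙 (step c z) * ∑ flags (λ b → 𝟙 (valid U′ z w b (next c)))))
        ≡⟨ ∑-cong bools (λ c → ∑-*ˡ words (𝟙 (step c z)) (λ w → ∑ flags (λ b → 𝟙 (valid U′ z w b (next c))))) ⟩
      ∑ bools (λ c → 𝟙 (step c z) * count k U′ z (next c))
        ∎
      where
      open ≡-Reasoning
      z : ℕ
      z = toℕ y
      U′ : ℕ → Bool
      U′ = insert U z

  count-barred : ∀ k U t u → count (suc k) U t (suc u) ≡
    ∑< n (λ z → 𝟙 (not (U z)) * count k (insert U z) z u
              + 𝟙 (not (U z) ∧ atLeast t z) * count k (insert U z) z (suc u))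
  count-barred k U t u = trans (∑-firstLetter k U t (suc u) step next unfold)
    (∑<-cong n (λ z _ → cong (𝟙 (not (U z)) * count k (insert U z) z u +_) (+-identityʳ _)))
    where
    step : Bool → ℕ → Bool
    step true  z = not (U z)
    step false z = not (U z) ∧ atLeast t z
    next : Bool → ℕ
    next true  = u
    next false = suc u
    unfold : ∀ y c (w : Vec (Fin n) k) b →
             𝟙 (valid U t (y ∷ᵥ w) (c ∷ᵥ b) (suc u))
             ≡ 𝟙 (step c (toℕ y)) * 𝟙 (valid (insert U (toℕ y)) (toℕ y) w b (next c))
    unfold y true  w b = 𝟙-∧ (step true (toℕ y)) _
    unfold y false w b = 𝟙-∧ (step false (toℕ y)) _

  count-unbarred : ∀ k U t → count (suc k) U t 0 ≡
    ∑< n (λ z → 𝟙 (not (U z) ∧ atLeast t z) * count k (insert U z) z 0)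
  count-unbarred k U t = trans (∑-firstLetter k U t 0 step (λ _ → 0) unfold)
    (∑<-cong n (λ z _ → +-identityʳ _))
    where
    step : Bool → ℕ → Bool
    step true  z = false
    step false z = not (U z) ∧ atLeast t z
    unfold : ∀ y c (w : Vec (Fin n) k) b →
             𝟙 (valid U t (y ∷ᵥ w) (c ∷ᵥ b) 0)
             ≡ 𝟙 (step c (toℕ y)) * 𝟙 (valid (insert U (toℕ y)) (toℕ y) w b 0)
    unfold y true  w b = refl
    unfold y false w b = 𝟙-∧ (step false (toℕ y)) _

  private
    not-∨-∧ : ∀ a e g → not (a ∨ e) ∧ g ≡ not a ∧ (not e ∧ g)
    not-∨-∧ true  e g = refl
    not-∨-∧ false e g = refl

    not-∨-∧true : ∀ a e → not (a ∨ e) ∧ true ≡ (not a ∧ true) ∧ not e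
    not-∨-∧true true  e     = refl
    not-∨-∧true false true  = refl
    not-∨-∧true false false = refl

  free-insert-above : ∀ U z → free (insert U z) z ≡ free U (suc z)
  free-insert-above U z = ∑<-cong n (λ w _ → cong 𝟙
    (trans (not-∨-∧ (U w) (z ≡ᵇ w) (atLeast z w)) (cong (not (U w) ∧_) (atLeast-suc z w))))

  free-insert : ∀ U z k → z < n → U z ≡ false → free U 0 ≡ suc k → free (insert U z) 0 ≡ k
  free-insert U z k z<n Uz≡false free≡1+k = suc-injective (begin
    suc (free (insert U z) 0)
      ≡⟨ +-comm 1 _ ⟩
    free (insert U z) 0 + 1
      ≡⟨ cong₂ _+_ (∑<-cong n (λ w _ → cong 𝟙 (not-∨-∧true (U w) (z ≡ᵇ w))))
                   (cong (λ b → 𝟙 (not b ∧ true)) (sym Uz≡false)) ⟩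
    ∑< n (λ w → 𝟙 ((not (U w) ∧ true) ∧ not (z ≡ᵇ w))) + 𝟙 (not (U z) ∧ true)
      ≡⟨ ∑-unmark n (λ w → not (U w) ∧ true) z z<n ⟩
    free U 0
      ≡⟨ free≡1+k ⟩
    suc k
      ∎)
    where open ≡-Reasoning

  count≡extensions : ∀ k U t u → free U 0 ≡ k → count k U t u ≡ extensions k (free U t) u

  afterLetter : ∀ k U u z a → z < n → free U 0 ≡ suc k →
    𝟙 (not (U z) ∧ a) * count k (insert U z) z u ≡ 𝟙 (not (U z) ∧ a) * extensions k (free U (suc z)) u
  afterLetter k U u z a z<n free≡1+k with U z in Uz
  ... | true  = refl
  ... | false = cong (𝟙 a *_) (begin
    count k (insert U z) z u
      ≡⟨ count≡extensions k (insert U z) z u (free-insert U z k z<n Uz free≡1+k) ⟩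
    extensions k (free (insert U z) z) u
      ≡⟨ cong (λ b → extensions k b u) (free-insert-above U z) ⟩
    extensions k (free U (suc z)) u
      ∎)
    where open ≡-Reasoning

  count≡extensions zero    U t zero    _ = refl
  count≡extensions zero    U t (suc u) _ = refl
  count≡extensions (suc k) U t (suc u) free≡1+k = begin
    count (suc k) U t (suc u)
      ≡⟨ count-barred k U t u ⟩
    ∑< n (λ z → 𝟙 (not (U z)) * count k (insert U z) z u
              + 𝟙 (not (U z) ∧ atLeast t z) * count k (insert U z) z (suc u))
      ≡⟨ ∑<-cong n (λ z z<n → cong₂ _+_
           (trans (cong (λ b → 𝟙 b * count k (insert U z) z u) (sym (∧-identityʳ (not (U z)))))
                  (afterLetter k U u z true z<n free≡1+k))
           (afterLetter k U (suc u) z (atLeast t z) z<n free≡1+k)) ⟩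
    ∑< n (λ z → 𝟙 (not (U z) ∧ true) * extensions k (free U (suc z)) u
              + 𝟙 (not (U z) ∧ atLeast t z) * extensions k (free U (suc z)) (suc u))
      ≡⟨ ∑<-+ n (λ z → 𝟙 (not (U z) ∧ true) * extensions k (free U (suc z)) u) _ ⟩
    ∑< n (λ z → 𝟙 (not (U z) ∧ true) * extensions k (free U (suc z)) u)
      + ∑< n (λ z → 𝟙 (not (U z) ∧ atLeast t z) * extensions k (free U (suc z)) (suc u))
      ≡⟨ cong₂ _+_ (∑-byRank n (not ∘ U) 0 (λ i → extensions k i u))
                   (∑-byRank n (not ∘ U) t (λ i → extensions k i (suc u))) ⟩
    ∑< (free U 0) (λ i → extensions k i u) + ∑< (free U t) (λ i → extensions k i (suc u))
      ≡⟨ cong (λ a → ∑< a (λ i → extensions k i u) + ∑< (free U t) (λ i → extensions k i (suc u))) free≡1+k ⟩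
    ∑< (suc k) (λ i → extensions k i u) + ∑< (free U t) (λ i → extensions k i (suc u))
      ≡⟨ +-comm (∑< (suc k) (λ i → extensions k i u)) _ ⟩
    extensions (suc k) (free U t) (suc u)
      ∎
    where open ≡-Reasoning
  count≡extensions (suc k) U t zero free≡1+k = begin
    count (suc k) U t 0
      ≡⟨ count-unbarred k U t ⟩
    ∑< n (λ z → 𝟙 (not (U z) ∧ atLeast t z) * count k (insert U z) z 0)
      ≡⟨ ∑<-cong n (λ z z<n → afterLetter k U 0 z (atLeast t z) z<n free≡1+k) ⟩
    ∑< n (λ z → 𝟙 (not (U z) ∧ atLeast t z) * extensions k (free U (suc z)) 0)
      ≡⟨ ∑-byRank n (not ∘ U) t (λ i → extensions k i 0) ⟩
    extensions (suc k) (free U t) 0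
      ∎
    where open ≡-Reasoning

commas : ∀ {m} → SegComp m → ℕ
commas = countV isComma

commaFreeWith : ℕ → ∀ {m} → SegComp m → Bool
commaFreeWith u I = (commas I ≡ᵇ 0) ∧ (seg I ≡ᵇ u)

separators≡commas+bars : ∀ {m} (I : SegComp m) → countV isSep I ≡ commas I + seg I
separators≡commas+bars []ᵥ           = refl
separators≡commas+bars (noSep ∷ᵥ I) = separators≡commas+bars I
separators≡commas+bars (comma ∷ᵥ I) = cong suc (separators≡commas+bars I)
separators≡commas+bars (bar ∷ᵥ I)   = trans (cong suc (separators≡commas+bars I)) (sym (+-suc (commas I) (seg I)))

des≡1+commas : ∀ {m} (I : SegComp m) → des I ≡ suc (commas I)
des≡1+commas I = trans (cong (λ s → suc s ∸ seg I) (separators≡commas+bars I)) (m+n∸n≡m (suc (commas I)) (seg I))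

des1-seg≡commaFree : ∀ u {m} (I : SegComp m) → (des I ≡ᵇ 1) ∧ (seg I ≡ᵇ u) ≡ commaFreeWith u I
des1-seg≡commaFree u I = cong (λ d → (d ≡ᵇ 1) ∧ (seg I ≡ᵇ u)) (des≡1+commas I)

-- For comma-free I, the only K with I ⪰ K is I itself: Des(K) ⊆ Des(I) = ∅
-- and Bar(I) ⊆ Bar(K) ⊆ Des(I) ∪ Bar(I) = Bar(I).
succeq-commaFree : ∀ {m} (I K : SegComp m) → (commas I ≡ᵇ 0) ≡ true → succeq I K ≡ sameComp I K
succeq-commaFree []ᵥ           []ᵥ           _ = refl
succeq-commaFree (noSep ∷ᵥ I) (noSep ∷ᵥ K) h = succeq-commaFree I K h
succeq-commaFree (noSep ∷ᵥ I) (comma ∷ᵥ K) h = refl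
succeq-commaFree (noSep ∷ᵥ I) (bar ∷ᵥ K)   h = refl
succeq-commaFree (bar ∷ᵥ I)   (noSep ∷ᵥ K) h = refl
succeq-commaFree (bar ∷ᵥ I)   (comma ∷ᵥ K) h = refl
succeq-commaFree (bar ∷ᵥ I)   (bar ∷ᵥ K)   h = succeq-commaFree I K h

∑-sameComp : ∀ m (J : SegComp m) (f : SegComp m → ℕ) →
             ∑ (allVec allSep m) (λ K → if sameComp J K then f K else 0) ≡ f J
∑-sameComp zero    []ᵥ       f = +-identityʳ (f []ᵥ)
∑-sameComp (suc m) (j ∷ᵥ J) f = trans (∑-allVec allSep m _) (atHead j)
  where
  rest : List (SegComp m)
  rest = allVec allSep m
  others : ∀ s → ∑ rest (λ K → if false ∧ sameComp J K then f (s ∷ᵥ K) else 0) ≡ 0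
  others s = ∑-zero rest
  atHead : ∀ j → ∑ allSep (λ s → ∑ rest (λ K → if (j ==ˢ s) ∧ sameComp J K then f (s ∷ᵥ K) else 0)) ≡ f (j ∷ᵥ J)
  atHead noSep = trans (cong₂ _+_ (∑-sameComp m J (f ∘ (noSep ∷ᵥ_))) (cong₂ _+_ (others comma) (cong (_+ 0) (others bar))))
                       (+-identityʳ _)
  atHead comma = trans (cong₂ _+_ (others noSep) (cong₂ _+_ (∑-sameComp m J (f ∘ (comma ∷ᵥ_))) (cong (_+ 0) (others bar))))
                       (+-identityʳ _)
  atHead bar   = trans (cong₂ _+_ (others noSep) (cong₂ _+_ (others comma) (cong (_+ 0) (∑-sameComp m J (f ∘ (bar ∷ᵥ_))))))
                       (+-identityʳ _)

-- SCDes, for words over an arbitrary alphabet Fin n (so that induction on the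
-- word is possible); on SP_{1+m} it is SCDes itself.
scdes : ∀ {n k} → Vec (Fin n) (suc k) → Vec Bool k → SegComp k
scdes {n} {k} w b = Data.Vec.tabulate pos
  where
  pos : Fin k → Sep
  pos i = if lookup b i then bar
          else (if toℕ (lookup w (fsuc i)) <ᵇ toℕ (lookup w (inject₁ i)) then comma else noSep)

avoids : ∀ {n k} → (ℕ → Bool) → Vec (Fin n) k → Bool
avoids U w = not (any (λ y → U (toℕ y)) (toList w))

open CommSemigroupProperties (CommutativeMonoid.commutativeSemigroup ∨-commutativeMonoid)
  using () renaming (interchange to ∨-interchange)

any-∨ : {A : Set} (p q : A → Bool) (xs : List A) → any (λ x → p x ∨ q x) xs ≡ any p xs ∨ any q xs
any-∨ p q []       = refl
any-∨ p q (x ∷ xs) = trans (cong ((p x ∨ q x) ∨_) (any-∨ p q xs)) (∨-interchange (p x) (q x) _ _)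

fresh-cons : ∀ {n k} U (y : Fin n) (w : Vec (Fin n) k) →
  avoids U (y ∷ᵥ w) ∧ distinct (toList (y ∷ᵥ w))
  ≡ not (U (toℕ y)) ∧ (avoids (insert U (toℕ y)) w ∧ distinct (toList w))
fresh-cons U y w = trans (regroup (U (toℕ y)) (any (λ z → U (toℕ z)) (toList w)))
  (cong (λ a → not (U (toℕ y)) ∧ (not a ∧ distinct (toList w)))
        (sym (any-∨ (λ z → U (toℕ z)) (λ z → toℕ y ≡ᵇ toℕ z) (toList w))))
  where
  regroup : ∀ a e → not (a ∨ e) ∧ (not (any (λ z → toℕ y ≡ᵇ toℕ z) (toList w)) ∧ distinct (toList w))
                  ≡ not a ∧ (not (e ∨ any (λ z → toℕ y ≡ᵇ toℕ z) (toList w)) ∧ distinct (toList w))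
  regroup true  e     = refl
  regroup false true  = refl
  regroup false false = refl

fresh-commaFree≡valid : ∀ {n k} U (x : Fin n) (w : Vec (Fin n) k) b u →
  (avoids U w ∧ distinct (toList w)) ∧ commaFreeWith u (scdes (x ∷ᵥ w) b) ≡ Runs.valid n U (toℕ x) w b u
fresh-commaFree≡valid U x []ᵥ       []ᵥ           zero    = refl
fresh-commaFree≡valid U x []ᵥ       []ᵥ           (suc u) = refl
fresh-commaFree≡valid U x (y ∷ᵥ w) (true ∷ᵥ b)  zero    =
  trans (cong ((avoids U (y ∷ᵥ w) ∧ distinct (toList (y ∷ᵥ w))) ∧_) (∧-zeroʳ (commas (scdes (y ∷ᵥ w) b) ≡ᵇ 0)))
        (∧-zeroʳ _)
fresh-commaFree≡valid U x (y ∷ᵥ w) (true ∷ᵥ b)  (suc u) = begin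
  (avoids U (y ∷ᵥ w) ∧ distinct (toList (y ∷ᵥ w))) ∧ commaFreeWith u (scdes (y ∷ᵥ w) b)
    ≡⟨ cong (_∧ commaFreeWith u (scdes (y ∷ᵥ w) b)) (fresh-cons U y w) ⟩
  (not (U (toℕ y)) ∧ fresh) ∧ commaFreeWith u (scdes (y ∷ᵥ w) b)
    ≡⟨ ∧-assoc (not (U (toℕ y))) fresh _ ⟩
  not (U (toℕ y)) ∧ (fresh ∧ commaFreeWith u (scdes (y ∷ᵥ w) b))
    ≡⟨ cong (not (U (toℕ y)) ∧_) (fresh-commaFree≡valid (insert U (toℕ y)) y w b u) ⟩
  not (U (toℕ y)) ∧ Runs.valid _ (insert U (toℕ y)) (toℕ y) w b u
    ∎
  where
  open ≡-Reasoning
  fresh : Bool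
  fresh = avoids (insert U (toℕ y)) w ∧ distinct (toList w)
fresh-commaFree≡valid U x (y ∷ᵥ w) (false ∷ᵥ b) u =
  trans (cong (_∧ commaFreeWith u (headSep (toℕ y <ᵇ toℕ x) ∷ᵥ scdes (y ∷ᵥ w) b)) (fresh-cons U y w))
        (trans (unbarredStep (toℕ y <ᵇ toℕ x))
               (cong ((not (U (toℕ y)) ∧ atLeast (toℕ x) (toℕ y)) ∧_)
                     (fresh-commaFree≡valid (insert U (toℕ y)) y w b u)))
  where
  headSep : Bool → Sep
  headSep d = if d then comma else noSep
  fresh : Bool
  fresh = avoids (insert U (toℕ y)) w ∧ distinct (toList w)
  rest : Bool
  rest = commaFreeWith u (scdes (y ∷ᵥ w) b)
  unbarredStep : ∀ d → (not (U (toℕ y)) ∧ fresh) ∧ commaFreeWith u (headSep d ∷ᵥ scdes (y ∷ᵥ w) b)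
                       ≡ (not (U (toℕ y)) ∧ not d) ∧ (fresh ∧ rest)
  unbarredStep true  = trans (∧-zeroʳ _) (sym (cong (_∧ (fresh ∧ rest)) (∧-zeroʳ (not (U (toℕ y))))))
  unbarredStep false = trans (∧-assoc (not (U (toℕ y))) fresh rest)
                             (cong (_∧ (fresh ∧ rest)) (sym (∧-identityʳ (not (U (toℕ y))))))

none : ℕ → Bool
none _ = false

commaFreeCount : ∀ m u → ∑ (allSP m) (λ σ → 𝟙 (commaFreeWith u (SCDes σ))) ≡ ordPart (suc u) (suc m)
commaFreeCount m u = begin
  ∑ (allSP m) (λ σ → 𝟙 (commaFreeWith u (SCDes σ)))
    ≡⟨ trans (∑-concatMap _ distinctWords _) (∑-cong distinctWords (λ w → ∑-map (w ,_) flags _)) ⟩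
  ∑ distinctWords (λ w → ∑ flags (λ b → 𝟙 (commaFreeWith u (scdes w b))))
    ≡⟨ ∑-filter (λ w → distinct (toList w)) words _ ⟩
  ∑ words (λ w → if distinct (toList w) then ∑ flags (λ b → 𝟙 (commaFreeWith u (scdes w b))) else 0)
    ≡⟨ ∑-cong words (λ w → onlyDistinct (distinct (toList w)) (λ b → commaFreeWith u (scdes w b))) ⟩
  ∑ words (λ w → ∑ flags (λ b → 𝟙 (distinct (toList w) ∧ commaFreeWith u (scdes w b))))
    ≡⟨ ∑-allVec letters m _ ⟩
  ∑ letters (λ x → ∑ (allVec letters m) (λ w → ∑ flags (λ b →
      𝟙 (distinct (toList (x ∷ᵥ w)) ∧ commaFreeWith u (scdes (x ∷ᵥ w) b)))))
    ≡⟨ ∑-tabulate (suc m) (λ x → x) _ (λ z → count m (insert none z) z u)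
         (λ x → ∑-cong (allVec letters m) (λ w → ∑-cong flags (λ b →
            cong 𝟙 (fresh-commaFree≡valid (insert none (toℕ x)) x w b u)))) ⟩
  ∑< (suc m) (λ z → count m (insert none z) z u)
    ≡⟨ ∑<-cong (suc m) firstLetter ⟩
  ∑< (suc m) (λ z → 𝟙 (not (none z) ∧ atLeast 0 z) * extensions m (free none (suc z)) u)
    ≡⟨ ∑-byRank (suc m) (not ∘ none) 0 (λ i → extensions m i u) ⟩
  ∑< (free none 0) (λ i → extensions m i u)
    ≡⟨ cong (λ a → ∑< a (λ i → extensions m i u)) allFree ⟩
  ∑< (suc m) (λ i → extensions m i u)
    ≡⟨ extensions-total m u ⟩
  ordPart (suc u) (suc m)
    ∎
  where
  open ≡-Reasoning
  open Runs (suc m)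
  letters : List (Fin (suc m))
  letters = allFin (suc m)
  flags : List (Vec Bool m)
  flags = allVec bools m
  words : List (Vec (Fin (suc m)) (suc m))
  words = allVec letters (suc m)
  distinctWords : List (Vec (Fin (suc m)) (suc m))
  distinctWords = filter (λ w → T? (distinct (toList w))) words

  allFree : free none 0 ≡ suc m
  allFree = ∑<-const (suc m)

  onlyDistinct : ∀ d (p : Vec Bool m → Bool) → (if d then ∑ flags (𝟙 ∘ p) else 0) ≡ ∑ flags (λ b → 𝟙 (d ∧ p b))
  onlyDistinct true  p = refl
  onlyDistinct false p = sym (∑-zero flags)

  firstLetter : ∀ z → z < suc m →
    count m (insert none z) z u ≡ 𝟙 (not (none z) ∧ atLeast 0 z) * extensions m (free none (suc z)) u
  firstLetter z z<1+m = trans (sym (*-identityˡ _)) (afterLetter m none u z true z<1+m allFree)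

frac : ℕ → (b : ℕ) → .{{NonZero b}} → ℚ
frac a b = ℤ.+ a /ℚ b

ι : ℕ → ℚ
ι a = frac a 1

toℚᵘ-frac : ∀ a d → toℚᵘ (frac a (suc d)) ≃ᵘ mkℚᵘ (ℤ.+ a) d
toℚᵘ-frac a d = ℚ.toℚᵘ-fromℚᵘ (mkℚᵘ (ℤ.+ a) d)

frac-cross : ∀ a b c d .{{_ : NonZero b}} .{{_ : NonZero d}} → a * d ≡ c * b → frac a b ≡ frac c d
frac-cross a (suc b) c (suc d) ad≡cb = ℚ.toℚᵘ-injective
  (ℚᵘ.≃-trans (toℚᵘ-frac a b) (ℚᵘ.≃-trans (*≡* crossℤ) (ℚᵘ.≃-sym (toℚᵘ-frac c d))))
  where
  crossℤ : ℤ.+ a ℤ.* ℤ.+ suc d ≡ ℤ.+ c ℤ.* ℤ.+ suc b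
  crossℤ = trans (sym (ℤ.pos-* a (suc d))) (trans (cong ℤ.+_ ad≡cb) (ℤ.pos-* c (suc b)))

frac-* : ∀ a b c d .{{_ : NonZero b}} .{{_ : NonZero d}} →
         frac a b *ℚ frac c d ≡ frac (a * c) (b * d) {{m*n≢0 b d}}
frac-* a (suc b) c (suc d) = ℚ.toℚᵘ-injective
  (ℚᵘ.≃-trans (ℚ.toℚᵘ-homo-* (frac a (suc b)) (frac c (suc d)))
  (ℚᵘ.≃-trans (ℚᵘ.*-cong (toℚᵘ-frac a b) (toℚᵘ-frac c d))
  (ℚᵘ.≃-trans (*≡* (cong (ℤ._* ℤ.+ (suc b * suc d)) (sym (ℤ.pos-* a c))))
              (ℚᵘ.≃-sym (toℚᵘ-frac (a * c) (d + b * suc d))))))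

ι-* : ∀ a b → ι (a * b) ≡ ι a *ℚ ι b
ι-* a b = sym (frac-* a 1 b 1)

ι-+ : ∀ a b → ι (a + b) ≡ ι a +ℚ ι b
ι-+ a b = ℚ.toℚᵘ-injective
  (ℚᵘ.≃-trans (toℚᵘ-frac (a + b) 0)
  (ℚᵘ.≃-trans (*≡* sumℤ)
  (ℚᵘ.≃-sym (ℚᵘ.≃-trans (ℚ.toℚᵘ-homo-+ (ι a) (ι b)) (ℚᵘ.+-cong (toℚᵘ-frac a 0) (toℚᵘ-frac b 0))))))
  where
  sumℤ : ℤ.+ (a + b) ℤ.* ℤ.+ 1 ≡ (ℤ.+ a ℤ.* ℤ.+ 1 ℤ.+ ℤ.+ b ℤ.* ℤ.+ 1) ℤ.* ℤ.+ 1
  sumℤ = trans (ℤ.*-identityʳ (ℤ.+ (a + b))) (trans (ℤ.pos-+ a b)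
           (sym (trans (ℤ.*-identityʳ _) (cong₂ ℤ._+_ (ℤ.*-identityʳ (ℤ.+ a)) (ℤ.*-identityʳ (ℤ.+ b))))))

scaledUnit-cross : ∀ a b c d .{{_ : NonZero b}} .{{_ : NonZero d}} →
                   a * d ≡ c * b → ι a *ℚ frac 1 b ≡ ι c *ℚ frac 1 d
scaledUnit-cross a b c d ad≡cb = begin
  ι a *ℚ frac 1 b       ≡⟨ frac-* a 1 1 b ⟩
  frac (a * 1) (1 * b)  ≡⟨ frac-cross (a * 1) (1 * b) (c * 1) (1 * d) cross ⟩
  frac (c * 1) (1 * d)  ≡⟨ sym (frac-* c 1 1 d) ⟩
  ι c *ℚ frac 1 d       ∎
  where
  open ≡-Reasoning
  instance
    1b≢0 : NonZero (1 * b)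
    1b≢0 = m*n≢0 1 b
    1d≢0 : NonZero (1 * d)
    1d≢0 = m*n≢0 1 d
  cross : a * 1 * (1 * d) ≡ c * 1 * (1 * b)
  cross = trans (cong₂ _*_ (*-identityʳ a) (*-identityˡ d))
                (trans ad≡cb (sym (cong₂ _*_ (*-identityʳ c) (*-identityˡ b))))

sumℚ-scaled : {A : Set} (xs : List A) (f : A → ℚ) (h : A → ℕ) (c : ℚ) →
              All (λ x → f x ≡ ι (h x) *ℚ c) xs → sumℚ (map f xs) ≡ ι (∑ xs h) *ℚ c
sumℚ-scaled []       f h c []            = sym (ℚ.*-zeroˡ c)
sumℚ-scaled (x ∷ xs) f h c (fx≡ ∷ fxs≡) = begin
  f x +ℚ sumℚ (map f xs)            ≡⟨ cong₂ _+ℚ_ fx≡ (sumℚ-scaled xs f h c fxs≡) ⟩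
  ι (h x) *ℚ c +ℚ ι (∑ xs h) *ℚ c   ≡⟨ sym (ℚ.*-distribʳ-+ c (ι (h x)) (ι (∑ xs h))) ⟩
  (ι (h x) +ℚ ι (∑ xs h)) *ℚ c      ≡⟨ cong (_*ℚ c) (sym (ι-+ (h x) (∑ xs h))) ⟩
  ι (h x + ∑ xs h) *ℚ c             ∎
  where open ≡-Reasoning

Σ-scaled : {A : Set} (xs : List A) (p : A → Bool) (f : A → ℚ) (h : A → ℕ) (c : ℚ) →
           (∀ x → f x ≡ ι (h x) *ℚ c) → Σ[ xs ∣ p ] f ≡ ι (∑ xs (λ x → if p x then h x else 0)) *ℚ c
Σ-scaled xs p f h c f≡ = sumℚ-scaled xs _ _ c (universal filtered xs)
  where
  filtered : ∀ x → (if p x then f x else 0ℚ) ≡ ι (if p x then h x else 0) *ℚ c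
  filtered x with p x
  ... | true  = f≡ x
  ... | false = sym (ℚ.*-zeroˡ c)

expDenominator≢0 : ∀ n → NonZero (2 ^ n * n !)
expDenominator≢0 n = m*n≢0 (2 ^ n) (n !) {{m^n≢0 2 n}} {{n !≢0}}

expHalfMinusOne : PS
expHalfMinusOne = expHalf -ˢ oneS

powerCoefficient : ∀ k n → (expHalfMinusOne ^ˢ k) n ≡ ι (ordPart k n) *ℚ expHalf n
powerCoefficient zero    zero    = refl
powerCoefficient zero    (suc n) = sym (ℚ.*-zeroˡ (expHalf (suc n)))
powerCoefficient (suc k) n       = begin
  0ℚ *ℚ (expHalfMinusOne ^ˢ k) n +ℚ sumℚ (map term (applyUpTo suc n))
    ≡⟨ cong (_+ℚ sumℚ (map term (applyUpTo suc n))) (ℚ.*-zeroˡ ((expHalfMinusOne ^ˢ k) n)) ⟩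
  0ℚ +ℚ sumℚ (map term (applyUpTo suc n))
    ≡⟨ ℚ.+-identityˡ _ ⟩
  sumℚ (map term (applyUpTo suc n))
    ≡⟨ sumℚ-scaled (applyUpTo suc n) term (λ j → (n C j) * ordPart k (n ∸ j)) (expHalf n)
                   (applyUpTo⁺₁ suc n termFormula) ⟩
  ι (∑ (applyUpTo suc n) (λ j → (n C j) * ordPart k (n ∸ j))) *ℚ expHalf n
    ≡⟨ cong (λ a → ι a *ℚ expHalf n) (∑-applyUpTo suc n _) ⟩
  ι (ordPart (suc k) n) *ℚ expHalf n
    ∎
  where
  open ≡-Reasoning
  term : ℕ → ℚ
  term j = expHalfMinusOne j *ℚ (expHalfMinusOne ^ˢ k) (n ∸ j)
  -- a first block of j ≥ 1 elements: 1/(2ʲ j!) · 1/(2^{n−j} (n−j)!) = C(n,j) / (2ⁿ n!)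
  termFormula : ∀ {j} → suc j ≤ n → term (suc j) ≡ ι ((n C suc j) * ordPart k (n ∸ suc j)) *ℚ expHalf n
  termFormula {j} 1+j≤n = begin
    (expHalf (suc j) +ℚ 0ℚ) *ℚ (expHalfMinusOne ^ˢ k) r
      ≡⟨ cong₂ _*ℚ_ (ℚ.+-identityʳ (expHalf (suc j))) (powerCoefficient k r) ⟩
    expHalf (suc j) *ℚ (ι e *ℚ expHalf r)
      ≡⟨ trans (sym (ℚ.*-assoc (expHalf (suc j)) (ι e) (expHalf r)))
             (trans (cong (_*ℚ expHalf r) (ℚ.*-comm (expHalf (suc j)) (ι e))) (ℚ.*-assoc (ι e) _ _)) ⟩
    ι e *ℚ (expHalf (suc j) *ℚ expHalf r)
      ≡⟨ cong (ι e *ℚ_) (frac-* 1 (2 ^ suc j * (suc j) !) 1 (2 ^ r * r !)) ⟩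
    ι e *ℚ frac 1 (Dj * Dr)
      ≡⟨ scaledUnit-cross e (Dj * Dr) ((n C suc j) * e) (2 ^ n * n !) cross ⟩
    ι ((n C suc j) * e) *ℚ expHalf n
      ∎
    where
    r e Dj Dr : ℕ
    r = n ∸ suc j
    e = ordPart k r
    Dj = 2 ^ suc j * (suc j) !
    Dr = 2 ^ r * r !
    instance
      Dj≢0 : NonZero Dj
      Dj≢0 = expDenominator≢0 (suc j)
      Dr≢0 : NonZero Dr
      Dr≢0 = expDenominator≢0 r
      Dn≢0 : NonZero (2 ^ n * n !)
      Dn≢0 = expDenominator≢0 n
      DjDr≢0 : NonZero (Dj * Dr)
      DjDr≢0 = m*n≢0 Dj Dr
    cross : e * (2 ^ n * n !) ≡ (n C suc j) * e * (Dj * Dr)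
    cross = trans (cong (e *_) (sym (expDenominator-split 1+j≤n))) (rearrange e (n C suc j) Dj Dr)
      where
      rearrange : ∀ e c a b → e * (a * b * c) ≡ c * e * (a * b)
      rearrange = solve-∀

-- Only K = I survives in S^I for a comma-free I, so Π_{1,u} restricted to size
-- 1 + m is the sum of G_σ over σ whose SCDes is comma-free with u bars.
φΠ-count : ∀ u m → φΠ u (suc m) ≡ ι (∑ (allSP m) (λ σ → 𝟙 (commaFreeWith u (SCDes σ)))) *ℚ φweight m
φΠ-count u m = begin
  φΠ u (suc m)
    ≡⟨ Σ-scaled comps singleDescent _ (λ I → ∑ comps (λ K → if succeq I K then cnt K else 0)) w
         (λ I → Σ-scaled comps (succeq I) _ cnt w
           (λ K → Σ-scaled (allSP m) _ (λ _ → w) (λ _ → 1) w (λ _ → sym (ℚ.*-identityˡ w)))) ⟩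
  ι (∑ comps (λ I → if singleDescent I then ∑ comps (λ K → if succeq I K then cnt K else 0) else 0)) *ℚ w
    ≡⟨ cong (λ a → ι a *ℚ w) (∑-cong comps (λ I →
         trans (cong (λ b → if b then ∑ comps (λ K → if succeq I K then cnt K else 0) else 0) (des1-seg≡commaFree u I))
               (onlyItself I))) ⟩
  ι (∑ comps (λ I → ∑ (allSP m) (λ σ → if sameComp (SCDes σ) I then 𝟙 (commaFreeWith u I) else 0))) *ℚ w
    ≡⟨ cong (λ a → ι a *ℚ w) (trans (∑-swap comps (allSP m) _)
                                    (∑-cong (allSP m) (λ σ → ∑-sameComp m (SCDes σ) (𝟙 ∘ commaFreeWith u)))) ⟩
  ι (∑ (allSP m) (λ σ → 𝟙 (commaFreeWith u (SCDes σ)))) *ℚ w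
    ∎
  where
  open ≡-Reasoning
  comps : List (SegComp m)
  comps = allVec allSep m
  w : ℚ
  w = φweight m
  singleDescent : SegComp m → Bool
  singleDescent I = (des I ≡ᵇ 1) ∧ (seg I ≡ᵇ u)
  cnt : SegComp m → ℕ
  cnt K = ∑ (allSP m) (λ σ → if sameComp (SCDes σ) K then 1 else 0)
  onlyItself : ∀ I → (if commaFreeWith u I then ∑ comps (λ K → if succeq I K then cnt K else 0) else 0)
                     ≡ ∑ (allSP m) (λ σ → if sameComp (SCDes σ) I then 𝟙 (commaFreeWith u I) else 0)
  onlyItself I with commaFreeWith u I in cf
  ... | true  = trans (∑-cong comps (λ K → cong (λ b → if b then cnt K else 0)
                                                (succeq-commaFree I K (∧-conicalˡ _ _ cf))))
                      (∑-sameComp m I cnt)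
  ... | false = sym (trans (∑-cong (allSP m) (λ σ → ifZero (sameComp (SCDes σ) I))) (∑-zero (allSP m)))
    where
    ifZero : ∀ b → (if b then 0 else 0) ≡ 0
    ifZero true  = refl
    ifZero false = refl

-- φ(G_σ) = x^{1+m} / (2^m (1+m)!) = 2 · x^{1+m} / (2^{1+m} (1+m)!).
φweight-halves : ∀ a m → ι a *ℚ φweight m ≡ ι 2 *ℚ (ι a *ℚ expHalf (suc m))
φweight-halves a m = begin
  ι a *ℚ φweight m
    ≡⟨ scaledUnit-cross a (2 ^ m * (suc m) !) (2 * a) (2 ^ suc m * (suc m) !) (double a (2 ^ m) ((suc m) !)) ⟩
  ι (2 * a) *ℚ expHalf (suc m)
    ≡⟨ cong (_*ℚ expHalf (suc m)) (ι-* 2 a) ⟩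
  ι 2 *ℚ ι a *ℚ expHalf (suc m)
    ≡⟨ ℚ.*-assoc (ι 2) (ι a) (expHalf (suc m)) ⟩
  ι 2 *ℚ (ι a *ℚ expHalf (suc m))
    ∎
  where
  open ≡-Reasoning
  instance
    weightDenominator≢0 : NonZero (2 ^ m * (suc m) !)
    weightDenominator≢0 = m*n≢0 (2 ^ m) ((suc m) !) {{m^n≢0 2 m}} {{(suc m) !≢0}}
    halfDenominator≢0 : NonZero (2 ^ suc m * (suc m) !)
    halfDenominator≢0 = expDenominator≢0 (suc m)
  double : ∀ a p f → a * (2 * p * f) ≡ 2 * a * (p * f)
  double = solve-∀

mainTheorem10 : (u : ℕ) → (n : ℕ) → φΠ u n ≡ rhsSeries u n
mainTheorem10 u zero = sym (begin
  ι 2 *ℚ (expHalfMinusOne ^ˢ suc u) 0  ≡⟨ cong (ι 2 *ℚ_) (powerCoefficient (suc u) 0) ⟩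
  ι 2 *ℚ (0ℚ *ℚ expHalf 0)             ≡⟨ cong (ι 2 *ℚ_) (ℚ.*-zeroˡ (expHalf 0)) ⟩
  ι 2 *ℚ 0ℚ                            ≡⟨ ℚ.*-zeroʳ (ι 2) ⟩
  0ℚ                                   ∎)
  where open ≡-Reasoning
mainTheorem10 u (suc m) = begin
  φΠ u (suc m)
    ≡⟨ φΠ-count u m ⟩
  ι (∑ (allSP m) (λ σ → 𝟙 (commaFreeWith u (SCDes σ)))) *ℚ φweight m
    ≡⟨ cong (λ a → ι a *ℚ φweight m) (commaFreeCount m u) ⟩
  ι (ordPart (suc u) (suc m)) *ℚ φweight m
    ≡⟨ φweight-halves (ordPart (suc u) (suc m)) m ⟩
  ι 2 *ℚ (ι (ordPart (suc u) (suc m)) *ℚ expHalf (suc m))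
    ≡⟨ cong (ι 2 *ℚ_) (sym (powerCoefficient (suc u) (suc m))) ⟩
  rhsSeries u (suc m)
    ∎
  where open ≡-Reasoning
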